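{- Let $N$ be a square-free integer with $N\equiv 5 \pmod 8$, let $\mathcal A_N=\mathbb Z[\sqrt N]$, and let $I_{+}=[4,\sqrt N+1]$ and $I_{ - }=[4,\sqrt N-1]$ be the ideals of $\mathcal A_N$ having the $\mathbb Z$-basis $\{4,\sqrt N\pm1\}$. The following are equivalent: (a) the equation $x^2-Ny^2=\pm4$ (for some choice of sign) has a solution in odd integers $x,y$; (b) there is an element of $\mathcal A_N$ of norm $\pm4$ that is not of the form $2\alpha$ with $\alpha\in\mathcal A_N$ (a "non-integral" element of norm $\pm4$, i.e. one whose quotient by $2$ lies outside $\mathcal A_N$); (c) the ideals $I_{+}$ and $I_{ - }$ are principal ideals of $\mathcal A_N$; (d) the numbers $\frac{\sqrt N+1}{4}$ and $\frac{\sqrt N-1}{4}$ are equivalent to $\sqrt N$.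
   Context: Two irrational real numbers $x,y$ are called equivalent if $y=\frac{px+q}{rx+s}$ for some integers $p,q,r,s$ with $ps-qr=\pm1$; equivalently, their simple continued fraction expansions eventually coincide. The norm of $u+v\sqrt N$ is $u^2-Nv^2$. -}

module Defs where

open import Data.Nat as ℕ using (ℕ)
open import Data.Nat.Divisibility using () renaming (_∣_ to _∣ℕ_)
open import Data.Integer as ℤ using (ℤ; +_; -_)
open import Data.Integer.Divisibility using () renaming (_∣_ to _∣ℤ_)
open import Data.Rational as ℚ using (ℚ)
open import Data.Product using (Σ; ∃; _×_; _,_)
open import Data.Sum using (_⊎_)
open import Relation.Binary.PropositionalEquality using (_≡_; _≢_)
open import Relation.Nullary using (¬_)

SquareFree : ℕ → Set
SquareFree n = ∀ (d : ℕ) → (d ℕ.* d) ∣ℕ n → d ≡ 1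

Odd : ℤ → Set
Odd x = ¬ (+ 2 ∣ℤ x)

-- The ring A_N = ℤ[√N]; the pair (u , v) stands for u + v√N.

ZN : Set
ZN = ℤ × ℤ

module _ (N : ℕ) where

  mulZN : ZN → ZN → ZN
  mulZN (a , b) (c , d) = (a ℤ.* c ℤ.+ + N ℤ.* b ℤ.* d , a ℤ.* d ℤ.+ b ℤ.* c)

  normZN : ZN → ℤ
  normZN (u , v) = u ℤ.* u ℤ.- + N ℤ.* v ℤ.* v

  PrincipalSet : ZN → ZN → Set
  PrincipalSet γ z = ∃ λ (α : ZN) → z ≡ mulZN γ α

  IsPrincipal : (ZN → Set) → Set
  IsPrincipal S = ∃ λ (γ : ZN) → ∀ (z : ZN) → (S z → PrincipalSet γ z) × (PrincipalSet γ z → S z)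

addZN : ZN → ZN → ZN
addZN (a , b) (c , d) = (a ℤ.+ c , b ℤ.+ d)

scaleZN : ℤ → ZN → ZN
scaleZN k (a , b) = (k ℤ.* a , k ℤ.* b)

ZSpan : ZN → ZN → ZN → Set
ZSpan ω₁ ω₂ z = ∃ λ (a : ℤ) → ∃ λ (b : ℤ) → z ≡ addZN (scaleZN a ω₁) (scaleZN b ω₂)

I₊ : ZN → Set
I₊ = ZSpan (+ 4 , + 0) (+ 1 , + 1)

I₋ : ZN → Set
I₋ = ZSpan (+ 4 , + 0) (- + 1 , + 1)

-- The real subfield ℚ(√N) ⊂ ℝ (N > 0 not a square); (u , v) = u + v√N.
-- Since √N is irrational, equality of reals in ℚ(√N) is equality of pairs.

QN : Set
QN = ℚ × ℚ

module _ (N : ℕ) where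

  mulQN : QN → QN → QN
  mulQN (a , b) (c , d) = (a ℚ.* c ℚ.+ (+ N ℚ./ 1) ℚ.* b ℚ.* d , a ℚ.* d ℚ.+ b ℚ.* c)

  addQN : QN → QN → QN
  addQN (a , b) (c , d) = (a ℚ.+ c , b ℚ.+ d)

  fromℤQN : ℤ → QN
  fromℤQN k = (k ℚ./ 1 , ℚ.0ℚ)

  Equivalent : QN → QN → Set
  Equivalent x y =
    ∃ λ (p : ℤ) → ∃ λ (q : ℤ) → ∃ λ (r : ℤ) → ∃ λ (s : ℤ) →
      ((p ℤ.* s ℤ.- q ℤ.* r ≡ + 1) ⊎ (p ℤ.* s ℤ.- q ℤ.* r ≡ - + 1)) ×
      (addQN (mulQN (fromℤQN r) x) (fromℤQN s) ≢ (ℚ.0ℚ , ℚ.0ℚ)) ×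
      (mulQN y (addQN (mulQN (fromℤQN r) x) (fromℤQN s))
        ≡ addQN (mulQN (fromℤQN p) x) (fromℤQN q))

sqrtN : QN
sqrtN = (ℚ.0ℚ , ℚ.1ℚ)

x₊ : QN
x₊ = (+ 1 ℚ./ 4 , + 1 ℚ./ 4)

x₋ : QN
x₋ = (- + 1 ℚ./ 4 , + 1 ℚ./ 4)

module Submission where

-- Write N = c² + 4t with c = ±1 and t = 2⌊N/8⌋ + 1 odd, so that I₊ and I₋ are the ideals
-- [4, c + √N].  The element 4a + b(c + √N) has norm 4Q(a, b), where
-- Q(a, b) = 4a² + 2cab − tb², and each of (a), (c), (d) says that Q represents ±1:
--   (a) an odd solution (x, y), with the sign of y chosen so that x ≡ cy (mod 4), is such an
--       element of norm ±4, and conversely Q(a, b) = ±1 forces b to be odd;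
--   (c) if Q(a, b) = ±1 then γ = 4a + b(c + √N) generates the ideal, because γγ̄ = 4Q(a, b);
--       conversely the norm 4Q of a generator divides N(4) = 16 and N(c + √N) = −4t, and
--       t odd forces Q = ±1;
--   (d) a unimodular map sends (c + √N)/4 to √N exactly when p = rc + 4s and Nr = pc + 4q,
--       and then ps − qr = Q(s, r).
-- Finally (b) is (a): since N is odd, an element of norm ±4 whose coordinates have different
-- parity would have odd norm, and one with both coordinates even is divisible by 2.

open import Defs
open import Data.Nat as ℕ using (ℕ; _%_)
import Data.Nat.Divisibility as ℕ
import Data.Nat.DivMod as ℕ
import Data.Nat.Properties as ℕ
open import Data.Integer using (ℤ; +_; -_; -[1+_]; _+_; _*_; _-_; ∣_∣; NonZero)
import Data.Integer.Properties as ℤ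
open import Data.Integer.DivMod using (_%ℕ_; _/ℕ_; n%ℕd<d; a≡a%ℕn+[a/ℕn]*n)
open import Data.Integer.Divisibility using () renaming (_∣_ to _∣ℤ_)
import Data.Integer.Divisibility.Signed as Signed
open import Data.Integer.Tactic.RingSolver using (solve-∀; solve)
open import Data.List using ([]; _∷_)
open import Data.Rational as ℚ using (ℚ; 0ℚ; 1ℚ)
import Data.Rational.Properties as ℚ
import Data.Rational.Unnormalised as ℚᵘ
import Data.Rational.Unnormalised.Properties as ℚᵘ
open import Data.Rational.Solver using (module +-*-Solver)
open import Data.Product using (∃; _×_; _,_; proj₁; proj₂)
open import Data.Sum using (_⊎_; inj₁; inj₂)
open import Function.Bundles using (_⇔_; mk⇔; Equivalence)
open import Relation.Binary.PropositionalEquality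
open import Relation.Nullary using (¬_)
open import Relation.Nullary.Negation using (contradiction)

-- Signs and parity

infix 4 _≡±_

_≡±_ : ℤ → ℤ → Set
a ≡± b = (a ≡ b) ⊎ (a ≡ - b)

*-congˡ-≡± : ∀ k {a b} → a ≡± b → k * a ≡± k * b
*-congˡ-≡± k (inj₁ refl) = inj₁ refl
*-congˡ-≡± k {b = b} (inj₂ refl) = inj₂ (sym (ℤ.neg-distribʳ-* k b))

*-cancelˡ-≡± : ∀ k {a b} .{{_ : NonZero k}} → k * a ≡± k * b → a ≡± b
*-cancelˡ-≡± k (inj₁ e) = inj₁ (ℤ.*-cancelˡ-≡ k _ _ e)
*-cancelˡ-≡± k {b = b} (inj₂ e) = inj₂ (ℤ.*-cancelˡ-≡ k _ _ (trans e (ℤ.neg-distribʳ-* k b)))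

≡±1⇒square≡1 : ∀ {a} → a ≡± + 1 → a * a ≡ + 1
≡±1⇒square≡1 (inj₁ refl) = refl
≡±1⇒square≡1 (inj₂ refl) = refl

unit-cancel : ∀ k → k * k ≡ + 1 → ∀ x → k * (k * x) ≡ x
unit-cancel k k²≡1 x = trans (sym (ℤ.*-assoc k k x)) (trans (cong (_* x) k²≡1) (ℤ.*-identityˡ x))

∣m∣≡1⇒m≡±1 : ∀ {m} → ∣ m ∣ ≡ 1 → m ≡± + 1
∣m∣≡1⇒m≡±1 {+ _} refl = inj₁ refl
∣m∣≡1⇒m≡±1 { -[1+ _ ]} refl = inj₂ refl

parity : ∀ z → ∃ λ a → (z ≡ + 2 * a) ⊎ (z ≡ + 2 * a + + 1)
parity z with z %ℕ 2 | n%ℕd<d z 2 | a≡a%ℕn+[a/ℕn]*n z 2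
... | 0 | _ | z≡ = z /ℕ 2 , inj₁ (trans z≡ (even (z /ℕ 2)))
  where
  even : ∀ q → + 0 + q * + 2 ≡ + 2 * q
  even = solve-∀
... | 1 | _ | z≡ = z /ℕ 2 , inj₂ (trans z≡ (odd (z /ℕ 2)))
  where
  odd : ∀ q → + 1 + q * + 2 ≡ + 2 * q + + 1
  odd = solve-∀
... | ℕ.suc (ℕ.suc _) | ℕ.s≤s (ℕ.s≤s ()) | _

even-2* : ∀ a → + 2 ∣ℤ + 2 * a
even-2* a = Signed.∣⇒∣ᵤ (Signed.divides a (ℤ.*-comm (+ 2) a))

2∤1 : ¬ 2 ℕ.∣ 1
2∤1 2∣1 with () ← ℕ.∣1⇒≡1 2∣1

odd-2*+1 : ∀ a → Odd (+ 2 * a + + 1)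
odd-2*+1 a 2∣2a+1 = 2∤1 (Signed.∣⇒∣ᵤ (Signed.∣m+n∣m⇒∣n {m = + 2 * a}
  (Signed.∣ᵤ⇒∣ 2∣2a+1) (Signed.divides a (ℤ.*-comm (+ 2) a))))

≡2*+1⇒odd : ∀ {z} a → z ≡ + 2 * a + + 1 → Odd z
≡2*+1⇒odd a refl = odd-2*+1 a

odd⇒2*+1 : ∀ {z} → Odd z → ∃ λ a → z ≡ + 2 * a + + 1
odd⇒2*+1 {z} odd with parity z
... | a , inj₁ refl = contradiction (even-2* a) odd
... | a , inj₂ z≡2a+1 = a , z≡2a+1

odd-*ˡ : ∀ x y → Odd (x * y) → Odd x
odd-*ˡ x y odd 2∣x = odd (subst (2 ℕ.∣_) (sym (ℤ.abs-* x y)) (ℕ.∣m⇒∣m*n ∣ y ∣ 2∣x))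

odd-neg : ∀ z → Odd z → Odd (- z)
odd-neg z odd 2∣-z = odd (subst (2 ℕ.∣_) (ℤ.∣-i∣≡∣i∣ z) 2∣-z)

≡±1⇒odd : ∀ {z} → z ≡± + 1 → Odd z
≡±1⇒odd (inj₁ refl) = 2∤1
≡±1⇒odd (inj₂ refl) = 2∤1

≡±4⇒¬odd : ∀ {z} → z ≡± + 4 → ¬ Odd z
≡±4⇒¬odd (inj₁ refl) odd = odd (ℕ.divides 2 refl)
≡±4⇒¬odd (inj₂ refl) odd = odd (ℕ.divides 2 refl)

¬odd-4* : ∀ x → ¬ Odd (+ 4 * x)
¬odd-4* x odd = odd (subst (+ 2 ∣ℤ_) (4*≡2*2* x) (even-2* (+ 2 * x)))
  where
  4*≡2*2* : ∀ x → + 2 * (+ 2 * x) ≡ + 4 * x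
  4*≡2*2* = solve-∀

odd∣4⇒≡1 : ∀ {n} → ¬ 2 ℕ.∣ n → n ℕ.∣ 4 → n ≡ 1
odd∣4⇒≡1 {0} _ 0∣4 with () ← ℕ.0∣⇒≡0 0∣4
odd∣4⇒≡1 {1} _ _ = refl
odd∣4⇒≡1 {2} odd _ = contradiction ℕ.∣-refl odd
odd∣4⇒≡1 {3} _ (ℕ.divides (ℕ.suc (ℕ.suc _)) ())
odd∣4⇒≡1 {4} odd _ = contradiction (ℕ.divides 2 refl) odd
odd∣4⇒≡1 {ℕ.suc (ℕ.suc (ℕ.suc (ℕ.suc (ℕ.suc _))))} _ n∣4
  with ℕ.s≤s (ℕ.s≤s (ℕ.s≤s (ℕ.s≤s ()))) ← ℕ.∣⇒≤ n∣4

odd∣4⇒≡±1 : ∀ m → Odd m → (∃ λ f → m * f ≡ + 4) → m ≡± + 1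
odd∣4⇒≡±1 m odd (f , mf≡4) = ∣m∣≡1⇒m≡±1 (odd∣4⇒≡1 odd (ℕ.divides ∣ f ∣ 4≡∣f∣∣m∣))
  where
  4≡∣f∣∣m∣ : 4 ≡ ∣ f ∣ ℕ.* ∣ m ∣
  4≡∣f∣∣m∣ = trans (cong ∣_∣ (sym mf≡4)) (trans (ℤ.abs-* m f) (ℕ.*-comm ∣ m ∣ ∣ f ∣))

odd-odd⇒≡±mod4 : ∀ {x y} → Odd x → Odd y → ∃ λ k → (x ≡ + 4 * k + y) ⊎ (x ≡ + 4 * k - y)
odd-odd⇒≡±mod4 {x} {y} odd-x odd-y with odd⇒2*+1 {x} odd-x | odd⇒2*+1 {y} odd-y
... | m , refl | n , refl with parity (m - n)
...   | j , inj₁ m-n≡2j = j , inj₁ (begin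
  + 2 * m + + 1                 ≡⟨ solve (m ∷ n ∷ []) ⟩
  + 2 * (m - n) + (+ 2 * n + + 1) ≡⟨ cong (λ d → + 2 * d + (+ 2 * n + + 1)) m-n≡2j ⟩
  + 2 * (+ 2 * j) + (+ 2 * n + + 1) ≡⟨ solve (j ∷ n ∷ []) ⟩
  + 4 * j + (+ 2 * n + + 1)     ∎)
  where open ≡-Reasoning
...   | j , inj₂ m-n≡2j+1 = j + n + + 1 , inj₂ (begin
  + 2 * m + + 1                 ≡⟨ solve (m ∷ n ∷ []) ⟩
  + 2 * (m - n) + (+ 2 * n + + 1) ≡⟨ cong (λ d → + 2 * d + (+ 2 * n + + 1)) m-n≡2j+1 ⟩
  + 2 * (+ 2 * j + + 1) + (+ 2 * n + + 1) ≡⟨ solve (j ∷ n ∷ []) ⟩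
  + 4 * (j + n + + 1) - (+ 2 * n + + 1) ∎)
  where open ≡-Reasoning

-- The ring ℤ[√N]

scaleZN-involutive : ∀ k → k * k ≡ + 1 → ∀ z → scaleZN k (scaleZN k z) ≡ z
scaleZN-involutive k k²≡1 (a , b) = cong₂ _,_ (unit-cancel k k²≡1 a) (unit-cancel k k²≡1 b)

module _ (N : ℕ) where

  mulZN-identityʳ : ∀ α → mulZN N α (+ 1 , + 0) ≡ α
  mulZN-identityʳ (a , b) = cong₂ _,_ (identity₁ (+ N) a b) (identity₂ a b)
    where
    identity₁ : ∀ n a b → a * + 1 + n * b * + 0 ≡ a
    identity₁ = solve-∀
    identity₂ : ∀ a b → a * + 0 + b * + 1 ≡ b
    identity₂ = solve-∀

  mulZN-scaleZNʳ : ∀ k α β → mulZN N α (scaleZN k β) ≡ scaleZN k (mulZN N α β)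
  mulZN-scaleZNʳ k (a , b) (c , d) = cong₂ _,_ (identity₁ (+ N) k a b c d) (identity₂ k a b c d)
    where
    identity₁ : ∀ n k a b c d → a * (k * c) + n * b * (k * d) ≡ k * (a * c + n * b * d)
    identity₁ = solve-∀
    identity₂ : ∀ k a b c d → a * (k * d) + b * (k * c) ≡ k * (a * d + b * c)
    identity₂ = solve-∀

  normZN-mulZN : ∀ α β → normZN N (mulZN N α β) ≡ normZN N α * normZN N β
  normZN-mulZN (a , b) (c , d) = identity (+ N) a b c d
    where
    identity : ∀ n a b c d →
      (a * c + n * b * d) * (a * c + n * b * d) - n * (a * d + b * c) * (a * d + b * c)
        ≡ (a * a - n * b * b) * (c * c - n * d * d)
    identity = solve-∀

  normZN-neg : ∀ x y → normZN N (x , - y) ≡ normZN N (x , y)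
  normZN-neg x y = identity (+ N) x y
    where
    identity : ∀ n x y → x * x - n * (- y) * (- y) ≡ x * x - n * y * y
    identity = solve-∀

  normZN-unit : ∀ k → k * k ≡ + 1 → ∀ x y → normZN N (x , k * y) ≡ normZN N (x , y)
  normZN-unit k k²≡1 x y = begin
    x * x - + N * (k * y) * (k * y) ≡⟨ identity (+ N) k x y ⟩
    x * x - + N * (k * k) * y * y   ≡⟨ cong (λ u → x * x - + N * u * y * y) k²≡1 ⟩
    x * x - + N * + 1 * y * y       ≡⟨ cong (λ u → x * x - u * y * y) (ℤ.*-identityʳ (+ N)) ⟩
    x * x - + N * y * y             ∎
    where
    open ≡-Reasoning
    identity : ∀ n k x y → x * x - n * (k * y) * (k * y) ≡ x * x - n * (k * k) * y * y
    identity = solve-∀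

  Indivisible : ZN → Set
  Indivisible α = ¬ (∃ λ (β : ZN) → α ≡ mulZN N (+ 2 , + 0) β)

  odd⇒indivisible : ∀ {x y} → Odd x → Indivisible (x , y)
  odd⇒indivisible odd ((b₁ , b₂) , eq) =
    odd (subst (+ 2 ∣ℤ_) (sym (trans (cong proj₁ eq) (identity (+ N) b₁ b₂))) (even-2* b₁))
    where
    identity : ∀ n a b → + 2 * a + n * + 0 * b ≡ + 2 * a
    identity = solve-∀

  indivisible⇒odd : Odd (+ N) → ∀ {u v} → normZN N (u , v) ≡± + 4 → Indivisible (u , v) →
                    Odd u × Odd v
  indivisible⇒odd odd-N {u} {v} norm≡±4 indivisible with parity u | parity v
  ... | a , inj₁ refl | b , inj₁ refl =
    contradiction ((a , b) , cong₂ _,_ (even₁ (+ N) a b) (even₂ a b)) indivisible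
    where
    even₁ : ∀ n a b → + 2 * a ≡ + 2 * a + n * + 0 * b
    even₁ = solve-∀
    even₂ : ∀ a b → + 2 * b ≡ + 2 * b + + 0 * a
    even₂ = solve-∀
  ... | a , inj₂ refl | b , inj₁ refl =
    contradiction (≡2*+1⇒odd (+ 2 * a * a + + 2 * a - + 2 * + N * b * b) (identity (+ N) a b))
                  (≡±4⇒¬odd norm≡±4)
    where
    identity : ∀ n a b → (+ 2 * a + + 1) * (+ 2 * a + + 1) - n * (+ 2 * b) * (+ 2 * b)
                          ≡ + 2 * (+ 2 * a * a + + 2 * a - + 2 * n * b * b) + + 1
    identity = solve-∀
  ... | a , inj₁ refl | b , inj₂ refl with odd⇒2*+1 {+ N} odd-N
  ...   | m , N≡2m+1 =
    contradiction (≡2*+1⇒odd (+ 2 * a * a - m * (+ 2 * b + + 1) * (+ 2 * b + + 1) - + 2 * b * b - + 2 * b - + 1)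
                             (identity N≡2m+1))
                  (≡±4⇒¬odd norm≡±4)
    where
    identity : ∀ {n} → n ≡ + 2 * m + + 1 →
      (+ 2 * a) * (+ 2 * a) - n * (+ 2 * b + + 1) * (+ 2 * b + + 1)
        ≡ + 2 * (+ 2 * a * a - m * (+ 2 * b + + 1) * (+ 2 * b + + 1) - + 2 * b * b - + 2 * b - + 1) + + 1
    identity refl = solve (m ∷ a ∷ b ∷ [])
  indivisible⇒odd odd-N norm≡±4 indivisible | a , inj₂ refl | b , inj₂ refl = odd-2*+1 a , odd-2*+1 b

  OddSolution : Set
  OddSolution = ∃ λ x → ∃ λ y → Odd x × Odd y × normZN N (x , y) ≡± + 4

  IndivisibleNorm±4 : Set
  IndivisibleNorm±4 = ∃ λ α → normZN N α ≡± + 4 × Indivisible α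

  oddSolution⇒indivisibleNorm±4 : OddSolution → IndivisibleNorm±4
  oddSolution⇒indivisibleNorm±4 (x , y , odd-x , _ , norm≡±4) = (x , y) , norm≡±4 , odd⇒indivisible odd-x

  indivisibleNorm±4⇒oddSolution : Odd (+ N) → IndivisibleNorm±4 → OddSolution
  indivisibleNorm±4⇒oddSolution odd-N ((u , v) , norm≡±4 , indivisible) =
    u , v , proj₁ odd-uv , proj₂ odd-uv , norm≡±4
    where
    odd-uv : Odd u × Odd v
    odd-uv = indivisible⇒odd odd-N norm≡±4 indivisible

-- Integers as rationals

ι : ℤ → ℚ
ι a = a ℚ./ 1

¼ : ℚ
¼ = + 1 ℚ./ 4

toℚᵘ-/ : ∀ a n → ℚ.toℚᵘ (a ℚ./ ℕ.suc n) ℚᵘ.≃ ℚᵘ.mkℚᵘ a n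
toℚᵘ-/ a n = ℚ.toℚᵘ-fromℚᵘ (ℚᵘ.mkℚᵘ a n)

/-injectiveˡ : ∀ {a b} n → a ℚ./ ℕ.suc n ≡ b ℚ./ ℕ.suc n → a ≡ b
/-injectiveˡ {a} {b} n eq with ℚ./-injective-≃ (ℚᵘ.mkℚᵘ a n) (ℚᵘ.mkℚᵘ b n) eq
... | ℚᵘ.*≡* a*d≡b*d = ℤ.*-cancelʳ-≡ a b (+ ℕ.suc n) a*d≡b*d

ι-+ : ∀ a b → ι (a + b) ≡ ι a ℚ.+ ι b
ι-+ a b = ℚ.toℚᵘ-injective (ℚᵘ.≃-trans (toℚᵘ-/ (a + b) 0) (ℚᵘ.≃-trans (ℚᵘ.*≡* (identity a b))
  (ℚᵘ.≃-sym (ℚᵘ.≃-trans (ℚ.toℚᵘ-homo-+ (ι a) (ι b)) (ℚᵘ.+-cong (toℚᵘ-/ a 0) (toℚᵘ-/ b 0))))))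
  where
  identity : ∀ a b → (a + b) * + 1 ≡ (a * + 1 + b * + 1) * + 1
  identity = solve-∀

ι-* : ∀ a b → ι (a * b) ≡ ι a ℚ.* ι b
ι-* a b = ℚ.toℚᵘ-injective (ℚᵘ.≃-trans (toℚᵘ-/ (a * b) 0)
  (ℚᵘ.≃-sym (ℚᵘ.≃-trans (ℚ.toℚᵘ-homo-* (ι a) (ι b)) (ℚᵘ.*-cong (toℚᵘ-/ a 0) (toℚᵘ-/ b 0)))))

/4≡ι*¼ : ∀ a → a ℚ./ 4 ≡ ι a ℚ.* ¼
/4≡ι*¼ a = ℚ.toℚᵘ-injective (ℚᵘ.≃-trans (toℚᵘ-/ a 3)
  (ℚᵘ.≃-sym (ℚᵘ.≃-trans (ℚ.toℚᵘ-homo-* (ι a) ¼) (ℚᵘ.≃-trans (ℚᵘ.*-cong (toℚᵘ-/ a 0) (toℚᵘ-/ (+ 1) 3))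
    (ℚᵘ.*≡* (cong (_* + 4) (ℤ.*-identityʳ a)))))))

ι*¼-injective : ∀ {a b} → ι a ℚ.* ¼ ≡ ι b ℚ.* ¼ → a ≡ b
ι*¼-injective {a} {b} eq = /-injectiveˡ 3 (trans (/4≡ι*¼ a) (trans eq (sym (/4≡ι*¼ b))))

ι-linear : ∀ a b d → ι (a * b + + 4 * d) ≡ ι a ℚ.* ι b ℚ.+ ι (+ 4) ℚ.* ι d
ι-linear a b d = trans (ι-+ (a * b) (+ 4 * d)) (cong₂ ℚ._+_ (ι-* a b) (ι-* (+ 4) d))

quarter : ℤ → QN
quarter c = (c ℚ./ 4 , ¼)

module QuarterPoint (N : ℕ) (c : ℤ) where
  open +-*-Solver using (con; _:+_; _:*_; _:=_) renaming (solve to solveℚ)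

  point : QN
  point = (ι c ℚ.* ¼ , ¼)

  quarter≡point : quarter c ≡ point
  quarter≡point = cong (_, ¼) (/4≡ι*¼ c)

  affine : ℤ → ℤ → QN
  affine r s = addQN N (mulQN N (fromℤQN N r) point) (fromℤQN N s)

  √N*affine₁ : ∀ r s → proj₁ (mulQN N sqrtN (affine r s)) ≡ ι (+ N * r) ℚ.* ¼
  √N*affine₁ r s = trans (identity (ι r) (ι s) (ι c) (ι (+ N))) (cong (ℚ._* ¼) (sym (ι-* (+ N) r)))
    where
    identity : ∀ R S C n →
      0ℚ ℚ.* ((R ℚ.* (C ℚ.* ¼) ℚ.+ n ℚ.* 0ℚ ℚ.* ¼) ℚ.+ S)
        ℚ.+ n ℚ.* 1ℚ ℚ.* ((R ℚ.* ¼ ℚ.+ 0ℚ ℚ.* (C ℚ.* ¼)) ℚ.+ 0ℚ)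
        ≡ (n ℚ.* R) ℚ.* ¼
    identity = solveℚ 4 (λ R S C n →
      con 0ℚ :* ((R :* (C :* con ¼) :+ n :* con 0ℚ :* con ¼) :+ S)
        :+ n :* con 1ℚ :* ((R :* con ¼ :+ con 0ℚ :* (C :* con ¼)) :+ con 0ℚ)
        := (n :* R) :* con ¼) refl

  √N*affine₂ : ∀ r s → proj₂ (mulQN N sqrtN (affine r s)) ≡ ι (r * c + + 4 * s) ℚ.* ¼
  √N*affine₂ r s = trans (identity (ι r) (ι s) (ι c) (ι (+ N))) (cong (ℚ._* ¼) (sym (ι-linear r c s)))
    where
    identity : ∀ R S C n →
      0ℚ ℚ.* ((R ℚ.* ¼ ℚ.+ 0ℚ ℚ.* (C ℚ.* ¼)) ℚ.+ 0ℚ)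
        ℚ.+ 1ℚ ℚ.* ((R ℚ.* (C ℚ.* ¼) ℚ.+ n ℚ.* 0ℚ ℚ.* ¼) ℚ.+ S)
        ≡ (R ℚ.* C ℚ.+ ι (+ 4) ℚ.* S) ℚ.* ¼
    identity = solveℚ 4 (λ R S C n →
      con 0ℚ :* ((R :* con ¼ :+ con 0ℚ :* (C :* con ¼)) :+ con 0ℚ)
        :+ con 1ℚ :* ((R :* (C :* con ¼) :+ n :* con 0ℚ :* con ¼) :+ S)
        := (R :* C :+ con (ι (+ 4)) :* S) :* con ¼) refl

  affine₁ : ∀ p q → proj₁ (affine p q) ≡ ι (p * c + + 4 * q) ℚ.* ¼
  affine₁ p q = trans (identity (ι p) (ι q) (ι c) (ι (+ N))) (cong (ℚ._* ¼) (sym (ι-linear p c q)))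
    where
    identity : ∀ P Q C n →
      (P ℚ.* (C ℚ.* ¼) ℚ.+ n ℚ.* 0ℚ ℚ.* ¼) ℚ.+ Q ≡ (P ℚ.* C ℚ.+ ι (+ 4) ℚ.* Q) ℚ.* ¼
    identity = solveℚ 4 (λ P Q C n →
      (P :* (C :* con ¼) :+ n :* con 0ℚ :* con ¼) :+ Q := (P :* C :+ con (ι (+ 4)) :* Q) :* con ¼) refl

  affine₂ : ∀ p q → proj₂ (affine p q) ≡ ι p ℚ.* ¼
  affine₂ p q = identity (ι p) (ι c)
    where
    identity : ∀ P C → (P ℚ.* ¼ ℚ.+ 0ℚ ℚ.* (C ℚ.* ¼)) ℚ.+ 0ℚ ≡ P ℚ.* ¼
    identity = solveℚ 2 (λ P C → (P :* con ¼ :+ con 0ℚ :* (C :* con ¼)) :+ con 0ℚ := P :* con ¼) refl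

  √N*affine≡affine⇔ : ∀ {p q r s} →
    mulQN N sqrtN (affine r s) ≡ affine p q ⇔ ((+ N * r ≡ p * c + + 4 * q) × (r * c + + 4 * s ≡ p))
  √N*affine≡affine⇔ {p} {q} {r} {s} = mk⇔
    (λ eq → ι*¼-injective (trans (sym (√N*affine₁ r s)) (trans (cong proj₁ eq) (affine₁ p q)))
          , ι*¼-injective (trans (sym (√N*affine₂ r s)) (trans (cong proj₂ eq) (affine₂ p q))))
    (λ (Nr≡pc+4q , rc+4s≡p) → cong₂ _,_
      (trans (√N*affine₁ r s) (trans (cong (λ z → ι z ℚ.* ¼) Nr≡pc+4q) (sym (affine₁ p q))))
      (trans (√N*affine₂ r s) (trans (cong (λ z → ι z ℚ.* ¼) rc+4s≡p) (sym (affine₂ p q)))))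

  affine≡0⇒r≡0 : ∀ {r s} → affine r s ≡ (0ℚ , 0ℚ) → r ≡ + 0
  affine≡0⇒r≡0 {r} {s} eq = ι*¼-injective (trans (sym (affine₂ r s)) (cong proj₂ eq))

-- The ideal [4, c + √N] and its norm form

module Ideal (N : ℕ) (c t : ℤ) (N≡c²+4t : + N ≡ c * c + + 4 * t) where

  I : ZN → Set
  I = ZSpan (+ 4 , + 0) (c , + 1)

  element : ℤ → ℤ → ZN
  element a b = (+ 4 * a + c * b , b)

  span≡element : ∀ a b → addZN (scaleZN a (+ 4 , + 0)) (scaleZN b (c , + 1)) ≡ element a b
  span≡element a b = cong₂ _,_ (identity₁ c a b) (identity₂ a b)
    where
    identity₁ : ∀ c a b → a * + 4 + b * c ≡ + 4 * a + c * b
    identity₁ = solve-∀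
    identity₂ : ∀ a b → a * + 0 + b * + 1 ≡ b
    identity₂ = solve-∀

  element∈I : ∀ a b → I (element a b)
  element∈I a b = a , b , sym (span≡element a b)

  I⇒element : ∀ {z} → I z → ∃ λ a → ∃ λ b → z ≡ element a b
  I⇒element (a , b , z≡) = a , b , trans z≡ (span≡element a b)

  normForm : ℤ → ℤ → ℤ
  normForm a b = + 4 * a * a + + 2 * c * a * b - t * b * b

  NormFormRepresents±1 : Set
  NormFormRepresents±1 = ∃ λ a → ∃ λ b → normForm a b ≡± + 1

  norm-element : ∀ a b → normZN N (element a b) ≡ + 4 * normForm a b
  norm-element a b = identity N≡c²+4t
    where
    identity : ∀ {n} → n ≡ c * c + + 4 * t →
      (+ 4 * a + c * b) * (+ 4 * a + c * b) - n * b * b ≡ + 4 * (+ 4 * a * a + + 2 * c * a * b - t * b * b)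
    identity refl = solve (c ∷ t ∷ a ∷ b ∷ [])

  normForm-even : ∀ a d → ¬ normForm a (+ 2 * d) ≡± + 1
  normForm-even a d Q≡±1 = ¬odd-4* (a * a + c * a * d - t * d * d) (subst Odd identity (≡±1⇒odd Q≡±1))
    where
    identity : + 4 * a * a + + 2 * c * a * (+ 2 * d) - t * (+ 2 * d) * (+ 2 * d)
                 ≡ + 4 * (a * a + c * a * d - t * d * d)
    identity = solve (c ∷ t ∷ a ∷ d ∷ [])

  normForm-multiple : ∀ {a b r s α} → element r s ≡ mulZN N (element a b) α →
                      normForm r s ≡ normForm a b * normZN N α
  normForm-multiple {a} {b} {r} {s} {α} eq = ℤ.*-cancelˡ-≡ (+ 4) _ _ (begin
    + 4 * normForm r s                  ≡⟨ sym (norm-element r s) ⟩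
    normZN N (element r s)              ≡⟨ cong (normZN N) eq ⟩
    normZN N (mulZN N (element a b) α)  ≡⟨ normZN-mulZN N (element a b) α ⟩
    normZN N (element a b) * normZN N α ≡⟨ cong (_* normZN N α) (norm-element a b) ⟩
    + 4 * normForm a b * normZN N α     ≡⟨ ℤ.*-assoc (+ 4) (normForm a b) (normZN N α) ⟩
    + 4 * (normForm a b * normZN N α)   ∎)
    where open ≡-Reasoning

  represents⇒principal : NormFormRepresents±1 → IsPrincipal N I
  represents⇒principal (a , b , Q≡±1) = γ , λ z → I⊆⟨γ⟩ z , ⟨γ⟩⊆I z
    where
    open ≡-Reasoning
    γ : ZN
    γ = element a b
    Q : ℤ
    Q = normForm a b

    -- γ · cofactor r s = Q · (4r + s(c + √N)), from γγ̄ = 4Q and γ̄(c + √N) = 4((ac − bt) + a√N).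
    cofactor : ℤ → ℤ → ZN
    cofactor r s = (r * (+ 4 * a + c * b) + s * (a * c - b * t) , s * a - r * b)

    γ*cofactor : ∀ r s → mulZN N γ (cofactor r s) ≡ scaleZN Q (element r s)
    γ*cofactor r s = cong₂ _,_ (identity₁ N≡c²+4t) identity₂
      where
      identity₁ : ∀ {n} → n ≡ c * c + + 4 * t →
        (+ 4 * a + c * b) * (r * (+ 4 * a + c * b) + s * (a * c - b * t)) + n * b * (s * a - r * b)
          ≡ (+ 4 * a * a + + 2 * c * a * b - t * b * b) * (+ 4 * r + c * s)
      identity₁ refl = solve (c ∷ t ∷ a ∷ b ∷ r ∷ s ∷ [])
      identity₂ : (+ 4 * a + c * b) * (s * a - r * b) + b * (r * (+ 4 * a + c * b) + s * (a * c - b * t))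
                    ≡ (+ 4 * a * a + + 2 * c * a * b - t * b * b) * s
      identity₂ = solve (c ∷ t ∷ a ∷ b ∷ r ∷ s ∷ [])

    I⊆⟨γ⟩ : ∀ z → I z → PrincipalSet N γ z
    I⊆⟨γ⟩ _ (r , s , refl) = scaleZN Q (cofactor r s) , trans (span≡element r s) (begin
      element r s                          ≡⟨ scaleZN-involutive Q (≡±1⇒square≡1 Q≡±1) (element r s) ⟨
      scaleZN Q (scaleZN Q (element r s))  ≡⟨ cong (scaleZN Q) (γ*cofactor r s) ⟨
      scaleZN Q (mulZN N γ (cofactor r s)) ≡⟨ mulZN-scaleZNʳ N Q γ (cofactor r s) ⟨
      mulZN N γ (scaleZN Q (cofactor r s)) ∎)

    -- γ√N = 4(bt − ac) + (4a + cb)(c + √N).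
    ⟨γ⟩⊆I : ∀ z → PrincipalSet N γ z → I z
    ⟨γ⟩⊆I _ ((e , f) , refl) =
      r , s , trans (cong₂ _,_ (identity₁ N≡c²+4t) identity₂) (sym (span≡element r s))
      where
      r : ℤ
      r = e * a + f * (b * t - a * c)
      s : ℤ
      s = e * b + f * (+ 4 * a + c * b)
      identity₁ : ∀ {n} → n ≡ c * c + + 4 * t →
        (+ 4 * a + c * b) * e + n * b * f
          ≡ + 4 * (e * a + f * (b * t - a * c)) + c * (e * b + f * (+ 4 * a + c * b))
      identity₁ refl = solve (c ∷ t ∷ a ∷ b ∷ e ∷ f ∷ [])
      identity₂ : (+ 4 * a + c * b) * f + b * e ≡ e * b + f * (+ 4 * a + c * b)
      identity₂ = solve (c ∷ a ∷ b ∷ e ∷ f ∷ [])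

  principal⇒represents : Odd t → IsPrincipal N I → NormFormRepresents±1
  principal⇒represents odd-t (γ , I≈⟨γ⟩) = generator-represents (I⇒element γ∈I)
    where
    γ∈I : I γ
    γ∈I = proj₂ (I≈⟨γ⟩ γ) ((+ 1 , + 0) , sym (mulZN-identityʳ N γ))

    normForm-4 : + 4 * + 1 * + 1 + + 2 * c * + 1 * + 0 - t * + 0 * + 0 ≡ + 4
    normForm-4 = solve (c ∷ t ∷ [])

    normForm-c+√N : + 4 * + 0 * + 0 + + 2 * c * + 0 * + 1 - t * + 1 * + 1 ≡ - t
    normForm-c+√N = solve (c ∷ t ∷ [])

    generator-represents : (∃ λ a → ∃ λ b → γ ≡ element a b) → NormFormRepresents±1
    generator-represents (a , b , γ≡element) = a , b , odd∣4⇒≡±1 Q Q-odd Q∣4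
      where
      Q : ℤ
      Q = normForm a b

      cofactor-norm : ∀ r s → ∃ λ α → Q * normZN N α ≡ normForm r s
      cofactor-norm r s =
        let (α , eq) = proj₁ (I≈⟨γ⟩ (element r s)) (element∈I r s)
        in α , sym (normForm-multiple {a} {b} {r} {s} {α} (trans eq (cong (λ g → mulZN N g α) γ≡element)))

      Q∣4 : ∃ λ f → Q * f ≡ + 4
      Q∣4 = let (α , Qn≡4) = cofactor-norm (+ 1) (+ 0) in normZN N α , trans Qn≡4 normForm-4

      Q-odd : Odd Q
      Q-odd = let (α , Qn≡-t) = cofactor-norm (+ 0) (+ 1)
              in odd-*ˡ Q (normZN N α) (subst Odd (sym (trans Qn≡-t normForm-c+√N)) (odd-neg t odd-t))

  N-odd : Odd c → Odd (+ N)
  N-odd odd-c with odd⇒2*+1 {c} odd-c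
  ... | m , c≡2m+1 = ≡2*+1⇒odd (+ 2 * m * m + + 2 * m + + 2 * t) (trans N≡c²+4t (identity c≡2m+1))
    where
    identity : ∀ {c} → c ≡ + 2 * m + + 1 →
      c * c + + 4 * t ≡ + 2 * (+ 2 * m * m + + 2 * m + + 2 * t) + + 1
    identity refl = solve (m ∷ t ∷ [])

  represents⇒oddSolution : Odd c → NormFormRepresents±1 → OddSolution N
  represents⇒oddSolution odd-c (a , b , Q≡±1) with parity b
  ... | d , inj₁ refl = contradiction Q≡±1 (normForm-even a d)
  ... | d , inj₂ refl = + 4 * a + c * (+ 2 * d + + 1) , + 2 * d + + 1 , odd-x , odd-2*+1 d , norm≡±4
    where
    norm≡±4 : normZN N (element a (+ 2 * d + + 1)) ≡± + 4
    norm≡±4 = subst (_≡± + 4) (sym (norm-element a _)) (*-congˡ-≡± (+ 4) Q≡±1)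

    odd-x : Odd (+ 4 * a + c * (+ 2 * d + + 1))
    odd-x with odd⇒2*+1 {c} odd-c
    ... | m , c≡2m+1 = ≡2*+1⇒odd (+ 2 * a + + 2 * m * d + m + d) (identity c≡2m+1)
      where
      identity : ∀ {c} → c ≡ + 2 * m + + 1 →
        + 4 * a + c * (+ 2 * d + + 1) ≡ + 2 * (+ 2 * a + + 2 * m * d + m + d) + + 1
      identity refl = solve (m ∷ a ∷ d ∷ [])

  congruent⇒represents : c * c ≡ + 1 → ∀ {k y} → normZN N (+ 4 * k + y , y) ≡± + 4 →
                         NormFormRepresents±1
  congruent⇒represents c²≡1 {k} {y} norm≡±4 =
    k , c * y , *-cancelˡ-≡± (+ 4) {normForm k (c * y)} {+ 1} (subst (_≡± + 4) norm≡4*normForm norm≡±4)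
    where
    open ≡-Reasoning
    norm≡4*normForm : normZN N (+ 4 * k + y , y) ≡ + 4 * normForm k (c * y)
    norm≡4*normForm = begin
      normZN N (+ 4 * k + y , y)     ≡⟨ normZN-unit N c c²≡1 (+ 4 * k + y) y ⟨
      normZN N (+ 4 * k + y , c * y) ≡⟨ cong (λ u → normZN N (+ 4 * k + u , c * y)) (unit-cancel c c²≡1 y) ⟨
      normZN N (element k (c * y))   ≡⟨ norm-element k (c * y) ⟩
      + 4 * normForm k (c * y)       ∎

  oddSolution⇒represents : c * c ≡ + 1 → OddSolution N → NormFormRepresents±1
  oddSolution⇒represents c²≡1 (x , y , odd-x , odd-y , norm≡±4) with odd-odd⇒≡±mod4 {x} {y} odd-x odd-y
  ... | k , inj₁ refl = congruent⇒represents c²≡1 {k} {y} norm≡±4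
  ... | k , inj₂ refl =
    congruent⇒represents c²≡1 {k} { - y} (subst (_≡± + 4) (sym (normZN-neg N (+ 4 * k - y) y)) norm≡±4)

  determinant≡normForm : ∀ {p q r s} → r * c + + 4 * s ≡ p → + N * r ≡ p * c + + 4 * q →
                         p * s - q * r ≡ normForm s r
  determinant≡normForm {q = q} {r} {s} refl Nr≡ = begin
    (r * c + + 4 * s) * s - q * r                 ≡⟨ cong (λ q → (r * c + + 4 * s) * s - q * r) q≡tr-sc ⟩
    (r * c + + 4 * s) * s - (t * r - s * c) * r   ≡⟨ solve (c ∷ t ∷ r ∷ s ∷ []) ⟩
    + 4 * s * s + + 2 * c * s * r - t * r * r     ∎
    where
    open ≡-Reasoning
    4q≡ : ∀ {n} → n ≡ c * c + + 4 * t → n * r ≡ (r * c + + 4 * s) * c + + 4 * q →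
          + 4 * q ≡ + 4 * (t * r - s * c)
    4q≡ refl nr≡ = begin
      + 4 * q                                                     ≡⟨ solve (c ∷ r ∷ s ∷ q ∷ []) ⟩
      ((r * c + + 4 * s) * c + + 4 * q) - (r * c + + 4 * s) * c   ≡⟨ cong (_- (r * c + + 4 * s) * c) nr≡ ⟨
      (c * c + + 4 * t) * r - (r * c + + 4 * s) * c               ≡⟨ solve (c ∷ t ∷ r ∷ s ∷ []) ⟩
      + 4 * (t * r - s * c)                                       ∎
    q≡tr-sc : q ≡ t * r - s * c
    q≡tr-sc = ℤ.*-cancelˡ-≡ (+ 4) q (t * r - s * c) (4q≡ N≡c²+4t Nr≡)

  equivalent⇔represents : Equivalent N (quarter c) sqrtN ⇔ NormFormRepresents±1
  equivalent⇔represents = mk⇔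
    (λ e → to (subst (λ x → Equivalent N x sqrtN) quarter≡point e))
    (λ r → subst (λ x → Equivalent N x sqrtN) (sym quarter≡point) (from r))
    where
    open QuarterPoint N c

    to : Equivalent N point sqrtN → NormFormRepresents±1
    to (p , q , r , s , det , _ , eq) =
      let (Nr≡pc+4q , rc+4s≡p) = Equivalence.to (√N*affine≡affine⇔ {p} {q} {r} {s}) eq
      in s , r , subst (_≡± + 1) (determinant≡normForm rc+4s≡p Nr≡pc+4q) det

    from : NormFormRepresents±1 → Equivalent N point sqrtN
    from (a , b , Q≡±1) = p , q , b , a , det , denominator≢0 , eq
      where
      p : ℤ
      p = b * c + + 4 * a
      q : ℤ
      q = t * b - a * c
      Nb≡pc+4q : + N * b ≡ p * c + + 4 * q
      Nb≡pc+4q = identity N≡c²+4t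
        where
        identity : ∀ {n} → n ≡ c * c + + 4 * t → n * b ≡ (b * c + + 4 * a) * c + + 4 * (t * b - a * c)
        identity refl = solve (c ∷ t ∷ a ∷ b ∷ [])
      det : p * a - q * b ≡± + 1
      det = subst (_≡± + 1) (sym (determinant≡normForm {p} {q} {b} {a} refl Nb≡pc+4q)) Q≡±1
      denominator≢0 : affine b a ≢ (0ℚ , 0ℚ)
      denominator≢0 affine≡0 =
        normForm-even a (+ 0) (subst (λ b → normForm a b ≡± + 1) (affine≡0⇒r≡0 {b} {a} affine≡0) Q≡±1)
      eq : mulQN N sqrtN (affine b a) ≡ affine p q
      eq = Equivalence.from (√N*affine≡affine⇔ {p} {q} {b} {a}) (Nb≡pc+4q , refl)

N%8≡5⇒N≡1+4t : ∀ {N} → N % 8 ≡ 5 → + N ≡ + 1 + + 4 * (+ 2 * + (N ℕ./ 8) + + 1)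
N%8≡5⇒N≡1+4t {N} N%8≡5 = begin
  + N                                ≡⟨ cong +_ (ℕ.m≡m%n+[m/n]*n N 8) ⟩
  + (N % 8 ℕ.+ q ℕ.* 8)              ≡⟨ cong (λ r → + (r ℕ.+ q ℕ.* 8)) N%8≡5 ⟩
  + (5 ℕ.+ q ℕ.* 8)                  ≡⟨ ℤ.pos-+ 5 (q ℕ.* 8) ⟩
  + 5 + + (q ℕ.* 8)                  ≡⟨ cong (λ m → + 5 + m) (ℤ.pos-* q 8) ⟩
  + 5 + + q * + 8                    ≡⟨ identity (+ q) ⟩
  + 1 + + 4 * (+ 2 * + q + + 1)      ∎
  where
  open ≡-Reasoning
  q : ℕ
  q = N ℕ./ 8
  identity : ∀ m → + 5 + m * + 8 ≡ + 1 + + 4 * (+ 2 * m + + 1)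
  identity = solve-∀

mainTheorem4 : (N : ℕ) → SquareFree N → N % 8 ≡ 5 →
    let
      A = ∃ λ (x : ℤ) → ∃ λ (y : ℤ) → Odd x × Odd y ×
            ((x * x - + N * y * y ≡ + 4) ⊎ (x * x - + N * y * y ≡ - + 4))
      B = ∃ λ (α : ZN) → ((normZN N α ≡ + 4) ⊎ (normZN N α ≡ - + 4)) ×
            ¬ (∃ λ (β : ZN) → α ≡ mulZN N (+ 2 , + 0) β)
      C = IsPrincipal N I₊ × IsPrincipal N I₋
      D = Equivalent N x₊ sqrtN × Equivalent N x₋ sqrtN
    in (A ⇔ B) × (A ⇔ C) × (A ⇔ D)
mainTheorem4 N _ N%8≡5 =
  mk⇔ (oddSolution⇒indivisibleNorm±4 N) (indivisibleNorm±4⇒oddSolution N (Plus.N-odd odd-1)) ,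
  mk⇔ (λ sol → Plus.represents⇒principal (represents₊ sol) , Minus.represents⇒principal (represents₋ sol))
      (λ (principal₊ , _) → solution₊ (Plus.principal⇒represents odd-t principal₊)) ,
  mk⇔ (λ sol → Equivalence.from Plus.equivalent⇔represents (represents₊ sol)
             , Equivalence.from Minus.equivalent⇔represents (represents₋ sol))
      (λ (equivalent₊ , _) → solution₊ (Equivalence.to Plus.equivalent⇔represents equivalent₊))
  where
  t : ℤ
  t = + 2 * + (N ℕ./ 8) + + 1

  odd-t : Odd t
  odd-t = odd-2*+1 (+ (N ℕ./ 8))

  odd-1 : Odd (+ 1)
  odd-1 = odd-2*+1 (+ 0)

  module Plus = Ideal N (+ 1) t (N%8≡5⇒N≡1+4t N%8≡5)
  module Minus = Ideal N (- + 1) t (N%8≡5⇒N≡1+4t N%8≡5)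

  represents₊ : OddSolution N → Plus.NormFormRepresents±1
  represents₊ = Plus.oddSolution⇒represents refl

  represents₋ : OddSolution N → Minus.NormFormRepresents±1
  represents₋ = Minus.oddSolution⇒represents refl

  solution₊ : Plus.NormFormRepresents±1 → OddSolution N
  solution₊ = Plus.represents⇒oddSolution odd-1
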